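{- Let $G$ be a $C_{4k}$-free bipartite graph. Then $\operatorname{Supp}(C_S(G))=\operatorname{Supp}(G)$, $\operatorname{Core}(C_S(G))=\operatorname{Core}(G)$, and $\operatorname{Npart}(C_N(G))=\operatorname{Npart}(G)$. Furthermore, $\operatorname{Npart}(C_S(G))=\operatorname{Supp}(C_N(G))=\operatorname{Core}(C_N(G))=\emptyset$.
   Context: All graphs are finite, simple and undirected. A graph is a $C_{4k}$-free bipartite graph if it is bipartite and contains no cycle whose length is a multiple of $4$. For a graph $G$, $\operatorname{Null}(G)$ is the null space of its adjacency matrix, viewed as a subspace of $\mathbb{R}^{V(G)}$; $\operatorname{Supp}(G)$ is the set of vertices $v$ with $\vec{x}_v\neq0$ for some $\vec{x}\in\operatorname{Null}(G)$; $\operatorname{Core}(G)$ is the set of vertices adjacent to some vertex of $\operatorname{Supp}(G)$; $\operatorname{Npart}(G)=V(G)\setminus(\operatorname{Supp}(G)\cup\operatorname{Core}(G))$. $C_S(G)$ is the subgraph of $G$ induced by $\operatorname{Supp}(G)\cup\operatorname{Core}(G)$, and $C_N(G)$ is the subgraph of $G$ induced by $\operatorname{Npart}(G)$.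
   Formalization: The null space of each graph is taken over ℚ instead of ℝ, so Supp, Core and Npart of G, $C_S(G)$ and $C_N(G)$ are defined through rational null vectors. -}

module Defs where

open import Data.Nat using (ℕ; zero; suc; _≤_)
open import Data.Nat.Divisibility using (_∣_)
open import Data.Fin using (Fin; zero; suc; inject₁; fromℕ)
open import Data.Bool using (Bool; true; false; if_then_else_)
open import Data.Rational using (ℚ; 0ℚ; _+_)
open import Data.Product using (_×_; ∃)
open import Relation.Nullary using (¬_)
open import Relation.Unary using (Pred; U; _∪_)
open import Relation.Binary.PropositionalEquality using (_≡_; _≢_)
open import Function.Definitions using (Injective)

record Graph (n : ℕ) : Set where
  field
    adj    : Fin n → Fin n → Bool
    sym    : ∀ u v → adj u v ≡ adj v u
    irrefl : ∀ v → adj v v ≡ false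
open Graph public

Σℚ : ∀ {n} → (Fin n → ℚ) → ℚ
Σℚ {zero}  f = 0ℚ
Σℚ {suc n} f = f zero + Σℚ (λ i → f (suc i))

-- Vertex subsets (predicates); an induced subgraph G[S] is represented
-- by the pair (G , S), keeping the original vertex labels.
VSet : ℕ → Set₁
VSet n = Pred (Fin n) _

Aℚ : ∀ {n} → Graph n → (Fin n → ℚ) → Fin n → ℚ
Aℚ G x v = Σℚ (λ u → if adj G v u then x u else 0ℚ)

-- x (extended by zero outside S) lies in the null space of the adjacency
-- matrix of the induced subgraph G[S].
IsNull : ∀ {n} → Graph n → VSet n → (Fin n → ℚ) → Set
IsNull G S x = (∀ v → ¬ S v → x v ≡ 0ℚ) × (∀ v → S v → Aℚ G x v ≡ 0ℚ)

Supp : ∀ {n} → Graph n → VSet n → VSet n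
Supp G S v = ∃ λ (x : Fin _ → ℚ) → IsNull G S x × x v ≢ 0ℚ

Core : ∀ {n} → Graph n → VSet n → VSet n
Core G S v = S v × ∃ λ u → Supp G S u × adj G v u ≡ true

Npart : ∀ {n} → Graph n → VSet n → VSet n
Npart G S v = S v × ¬ Supp G S v × ¬ Core G S v

CS : ∀ {n} → Graph n → VSet n
CS G = Supp G U ∪ Core G U

CN : ∀ {n} → Graph n → VSet n
CN G = Npart G U

Bipartite : ∀ {n} → Graph n → Set
Bipartite {n} G = ∃ λ (c : Fin n → Bool) → ∀ u v → adj G u v ≡ true → c u ≢ c v

IsCycle : ∀ {n} → Graph n → (m : ℕ) → (Fin (suc m) → Fin n) → Set
IsCycle G m f = 3 ≤ suc m × Injective _≡_ _≡_ f
              × (∀ (i : Fin m) → adj G (f (inject₁ i)) (f (suc i)) ≡ true)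
              × adj G (f (fromℕ m)) (f zero) ≡ true

C4kFree : ∀ {n} → Graph n → Set
C4kFree {n} G = ∀ m (f : Fin (suc m) → Fin n) → IsCycle G m f → ¬ (4 ∣ suc m)

{-# OPTIONS --safe #-}
module Submission where

open import Defs renaming (sym to adj-sym)
open import Data.Product using (Σ; ∃; _×_; _,_; proj₁; proj₂)
open import Relation.Unary using (U; _≐_; Empty)

open import Algebra.Bundles using (CommutativeRing)
open import Data.Bool.Base using (Bool; true; false; not; if_then_else_)
open import Data.Bool.Properties using (¬-not; not-¬; not-involutive)
open import Data.Empty using (⊥)
open import Data.Fin.Base using (Fin; zero; suc; toℕ; inject₁; fromℕ; punchIn)
open import Data.Fin.Properties using (all?; ¬∀⟶∃¬; punchInᵢ≢i) renaming (_≟_ to _≟ᶠ_)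
open import Data.Nat.Base using (ℕ; zero; suc)
open import Data.Rational.Base using (ℚ; 0ℚ; 1ℚ)
open import Data.Rational.Properties using (+-*-commutativeRing) renaming (_≟_ to _≟ℚ_)
open import Data.Sum.Base using (_⊎_; inj₁; inj₂; [_,_]′)
open import Data.Unit.Base using (tt)
open import Function.Base using (_∘_; flip)
open import Function.Definitions using (Injective)
open import Relation.Binary.Definitions using (tri<; tri≈; tri>)
open import Relation.Binary.PropositionalEquality
open import Relation.Nullary using (Dec; yes; no; does)
open import Relation.Nullary.Decidable using (dec-true; dec-false; decidable-stable; ¬¬-excluded-middle)
open import Relation.Nullary.Negation using (¬_; contradiction)
open import Algebra.Properties.Semiring.Sum (CommutativeRing.semiring +-*-commutativeRing)
  using (sum; sum-cong-≗; sum-replicate-zero; sum-remove)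

-- Fix a maximum matching m and let R be the set of vertices reached from an m-unmatched vertex by
-- an even alternating path.  The engine is a sign walk: let T be a set of matched vertices such that
-- (A x) vanishes at the mates of T and every neighbour u of a mate of t ∈ T with x u ≠ 0 lies in T.
-- If x t ≠ 0 for some t ∈ T, the zero row at the mate of t contains a term of the opposite sign,
-- at a vertex that is again in T; iterating, the walk t, mate t, t′, mate t′, … revisits a vertex
-- after an even number of steps (the signs alternate), which closes up into a cycle of length
-- divisible by 4.  So x vanishes on T.  With suitable T this shows that Supp(G) = R (for R ⊆ Supp(G),
-- swapping along an alternating path makes the vertex unmatched, and the Fredholm alternative gives
-- a vector to walk on), that every vertex of Core(G) = N(R) is matched into Supp(G), and that m maps
-- Npart(G) into itself.  Hence null vectors of C_S(G) vanish on Core(G) and extend by zero to null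
-- vectors of G, while C_N(G) has trivial null space; the six identities follow.

edge-sym : ∀ {n} (G : Graph n) {u v} → adj G u v ≡ true → adj G v u ≡ true
edge-sym G {u} {v} uv = trans (adj-sym G v u) uv

module Sums where

  open import Data.Rational.Base using (_+_; _*_; -_; _-_; _<_; _≤_)
  open import Data.Rational.Properties
    using (neg-distrib-+; *-zeroˡ; ≤-refl; +-mono-≤; +-mono-<-≤; _≤?_; _<?_; <⇒≢; ≰⇒>; neg-antimono-<;
           <-cmp; <-asym)
  open import Data.Rational.Solver using (module +-*-Solver)
  open import Algebra.Properties.Ring (CommutativeRing.ring +-*-commutativeRing) using (-‿involutive)
  open +-*-Solver
  open ≡-Reasoning

  Σℚ≗sum : ∀ {n} (f : Fin n → ℚ) → Σℚ f ≡ sum f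
  Σℚ≗sum {zero}  f = refl
  Σℚ≗sum {suc n} f = cong (f zero +_) (Σℚ≗sum (f ∘ suc))

  sum-zero : ∀ {n} {f : Fin n → ℚ} → (∀ i → f i ≡ 0ℚ) → sum f ≡ 0ℚ
  sum-zero {n} f≡0 = trans (sum-cong-≗ f≡0) (sum-replicate-zero n)

  sum-neg : ∀ {n} (f : Fin n → ℚ) → sum (-_ ∘ f) ≡ - sum f
  sum-neg {zero}  f = refl
  sum-neg {suc n} f = trans (cong (- f zero +_) (sum-neg (f ∘ suc))) (sym (neg-distrib-+ (f zero) _))

  sum-sub-scaled : ∀ {n} (f g : Fin n → ℚ) r → sum (λ i → f i - r * g i) ≡ sum f - r * sum g
  sum-sub-scaled {zero}  f g r = solve 1 (λ r → con 0ℚ := con 0ℚ :- r :* con 0ℚ) refl r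
  sum-sub-scaled {suc n} f g r = begin
    f zero - r * g zero + sum (λ i → f (suc i) - r * g (suc i))
      ≡⟨ cong (f zero - r * g zero +_) (sum-sub-scaled (f ∘ suc) (g ∘ suc) r) ⟩
    f zero - r * g zero + (sum (f ∘ suc) - r * sum (g ∘ suc))
      ≡⟨ solve 5 (λ a b F G r → a :- r :* b :+ (F :- r :* G) := a :+ F :- r :* (b :+ G)) refl
           (f zero) (g zero) (sum (f ∘ suc)) (sum (g ∘ suc)) r ⟩
    sum f - r * sum g ∎

  δ : ∀ {n} → Fin n → Fin n → ℚ
  δ p i = if does (p ≟ᶠ i) then 1ℚ else 0ℚ

  δ-diag : ∀ {n} (p : Fin n) → δ p p ≡ 1ℚ
  δ-diag p rewrite dec-true (p ≟ᶠ p) refl = refl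

  δ-off : ∀ {n} {p i : Fin n} → p ≢ i → δ p i ≡ 0ℚ
  δ-off {p = p} {i} p≢i rewrite dec-false (p ≟ᶠ i) p≢i = refl

  sum-δ : ∀ {n} (p : Fin n) (f : Fin n → ℚ) → sum (λ i → δ p i * f i) ≡ f p
  sum-δ {suc n} p f = begin
    sum g                              ≡⟨ sum-remove {i = p} g ⟩
    g p + sum (λ j → g (punchIn p j))  ≡⟨ cong₂ _+_ (cong (_* f p) (δ-diag p)) (sum-zero off-p) ⟩
    1ℚ * f p + 0ℚ                      ≡⟨ solve 1 (λ x → con 1ℚ :* x :+ con 0ℚ := x) refl (f p) ⟩
    f p                                ∎
    where
    g = λ i → δ p i * f i
    off-p : ∀ j → g (punchIn p j) ≡ 0ℚ
    off-p j = trans (cong (_* f (punchIn p j)) (δ-off (punchInᵢ≢i p j ∘ sym))) (*-zeroˡ (f (punchIn p j)))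

  sum-nonneg : ∀ {n} {f : Fin n → ℚ} → (∀ i → 0ℚ ≤ f i) → 0ℚ ≤ sum f
  sum-nonneg {zero}  f≥0 = ≤-refl
  sum-nonneg {suc n} f≥0 = +-mono-≤ (f≥0 zero) (sum-nonneg (f≥0 ∘ suc))

  sum-pos : ∀ {n} {f : Fin (suc n) → ℚ} t → (∀ i → 0ℚ ≤ f i) → 0ℚ < f t → 0ℚ < sum f
  sum-pos {f = f} t f≥0 ft>0 =
    subst (0ℚ <_) (sym (sum-remove {i = t} f)) (+-mono-<-≤ ft>0 (sum-nonneg (f≥0 ∘ punchIn t)))

  zero-sum⇒negative-term : ∀ {n} {f : Fin n → ℚ} {t} →
                           sum f ≡ 0ℚ → 0ℚ < f t → ∃ λ u → f u < 0ℚ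
  zero-sum⇒negative-term {suc n} {f} {t} Σf≡0 ft>0 with all? (λ i → 0ℚ ≤? f i)
  ... | yes f≥0 = contradiction (sym Σf≡0) (<⇒≢ (sum-pos t f≥0 ft>0))
  ... | no f≱0  = let u , 0≰fu = ¬∀⟶∃¬ _ _ (λ i → 0ℚ ≤? f i) f≱0 in u , ≰⇒> 0≰fu

  zero-sum⇒positive-term : ∀ {n} {f : Fin n → ℚ} {t} →
                           sum f ≡ 0ℚ → f t < 0ℚ → ∃ λ u → 0ℚ < f u
  zero-sum⇒positive-term {f = f} Σf≡0 ft<0 =
    let u , -fu<0 = zero-sum⇒negative-term (trans (sum-neg f) (cong -_ Σf≡0)) (neg-antimono-< ft<0)
    in u , subst (0ℚ <_) (-‿involutive (f u)) (neg-antimono-< -fu<0)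

  sign : ℚ → Bool
  sign q = does (0ℚ <? q)

  zero-sum⇒sign-change : ∀ {n} {f : Fin n → ℚ} {t} → sum f ≡ 0ℚ → f t ≢ 0ℚ →
                         ∃ λ u → f u ≢ 0ℚ × sign (f u) ≡ not (sign (f t))
  zero-sum⇒sign-change {f = f} {t} Σf≡0 ft≢0 with <-cmp 0ℚ (f t)
  ... | tri< ft>0 _ _ = let u , fu<0 = zero-sum⇒negative-term Σf≡0 ft>0 in
    u , <⇒≢ fu<0 ,
    trans (dec-false (0ℚ <? f u) (<-asym fu<0)) (cong not (sym (dec-true (0ℚ <? f t) ft>0)))
  ... | tri≈ _ 0≡ft _ = contradiction (sym 0≡ft) ft≢0
  ... | tri> _ _ ft<0 = let u , fu>0 = zero-sum⇒positive-term Σf≡0 ft<0 in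
    u , ≢-sym (<⇒≢ fu>0) ,
    trans (dec-true (0ℚ <? f u) fu>0) (cong not (sym (dec-false (0ℚ <? f t) (<-asym ft<0))))

open Sums

module Fredholm where

  open import Data.Rational.Base using (_+_; _*_; _-_; 1/_; ≢-nonZero)
  open import Data.Rational.Properties
    using (*-zeroʳ; +-identityˡ; *-assoc; *-identityʳ; *-inverseˡ; *-inverseʳ; *-comm; +-inverseʳ)
  open import Data.Rational.Solver using (module +-*-Solver)
  open import Data.Sum.Base using (map)
  open import Data.Vec.Functional using (_∷_)
  open +-*-Solver
  open ≡-Reasoning

  open ≡-Reasoning
  open +-*-Solver

  module _ {m k : ℕ} where

    Solvable : (Fin m → Fin k → ℚ) → (Fin m → ℚ) → Set
    Solvable M b = ∃ λ (w : Fin k → ℚ) → ∀ i → sum (λ j → M i j * w j) ≡ b i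

    Obstructed : (Fin m → Fin k → ℚ) → (Fin m → ℚ) → Set
    Obstructed M b = ∃ λ (y : Fin m → ℚ) →
      (∀ j → sum (λ i → y i * M i j) ≡ 0ℚ) × sum (λ i → y i * b i) ≢ 0ℚ

  module ZeroColumn {m k} (M : Fin m → Fin (suc k) → ℚ) (b : Fin m → ℚ)
                    (M·0≡0 : ∀ i → M i zero ≡ 0ℚ) where

    M′ : Fin m → Fin k → ℚ
    M′ i j = M i (suc j)

    lift-solution : Solvable M′ b → Solvable M b
    lift-solution (w , Mw≡b) = 0ℚ ∷ w , λ i →
      trans (cong (_+ sum (λ j → M′ i j * w j)) (*-zeroʳ (M i zero)))
            (trans (+-identityˡ (sum (λ j → M′ i j * w j))) (Mw≡b i))

    lift-obstruction : Obstructed M′ b → Obstructed M b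
    lift-obstruction (y , yM≡0 , yb≢0) = y , yM≡0′ , yb≢0
      where
      yM≡0′ : ∀ j → sum (λ i → y i * M i j) ≡ 0ℚ
      yM≡0′ zero    = sum-zero (λ i → trans (cong (y i *_) (M·0≡0 i)) (*-zeroʳ (y i)))
      yM≡0′ (suc j) = yM≡0 j

  module Pivot {m k} (M : Fin m → Fin (suc k) → ℚ) (b : Fin m → ℚ)
               (p : Fin m) (pivot≢0 : M p zero ≢ 0ℚ) where

    instance _ = ≢-nonZero pivot≢0

    ratio : Fin m → ℚ
    ratio i = M i zero * 1/ M p zero

    eliminate : (Fin m → ℚ) → Fin m → ℚ
    eliminate c i = c i - ratio i * c p

    M′ : Fin m → Fin k → ℚ
    M′ i j = eliminate (λ i → M i (suc j)) i

    ratio-pivot : ∀ i → ratio i * M p zero ≡ M i zero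
    ratio-pivot i = begin
      M i zero * 1/ M p zero * M p zero   ≡⟨ *-assoc (M i zero) _ _ ⟩
      M i zero * (1/ M p zero * M p zero) ≡⟨ cong (M i zero *_) (*-inverseˡ (M p zero)) ⟩
      M i zero * 1ℚ                       ≡⟨ *-identityʳ (M i zero) ⟩
      M i zero                            ∎

    lift-solution : Solvable M′ (eliminate b) → Solvable M b
    lift-solution (w , M′w≡b′) = w₀ ∷ w , row
      where
      X : Fin m → ℚ
      X i = sum (λ j → M i (suc j) * w j)
      w₀ = (b p - X p) * 1/ M p zero
      pivot-row : M p zero * w₀ ≡ b p - X p
      pivot-row = begin
        M p zero * ((b p - X p) * 1/ M p zero)
          ≡⟨ solve 3 (λ a x c → a :* (x :* c) := x :* (a :* c)) refl (M p zero) (b p - X p) (1/ M p zero) ⟩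
        (b p - X p) * (M p zero * 1/ M p zero)
          ≡⟨ cong ((b p - X p) *_) (*-inverseʳ (M p zero)) ⟩
        (b p - X p) * 1ℚ
          ≡⟨ *-identityʳ _ ⟩
        b p - X p ∎
      eliminated-row : ∀ i → X i - ratio i * X p ≡ b i - ratio i * b p
      eliminated-row i = begin
        X i - ratio i * X p
          ≡⟨ sym (sum-sub-scaled (λ j → M i (suc j) * w j) (λ j → M p (suc j) * w j) (ratio i)) ⟩
        sum (λ j → M i (suc j) * w j - ratio i * (M p (suc j) * w j))
          ≡⟨ sum-cong-≗ (λ j → solve 4 (λ a r c x → a :* x :- r :* (c :* x) := (a :- r :* c) :* x)
                                        refl (M i (suc j)) (ratio i) (M p (suc j)) (w j)) ⟩
        sum (λ j → M′ i j * w j)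
          ≡⟨ M′w≡b′ i ⟩
        b i - ratio i * b p ∎
      row : ∀ i → sum (λ j → M i j * (w₀ ∷ w) j) ≡ b i
      row i = begin
        M i zero * w₀ + X i
          ≡⟨ cong (λ a → a * w₀ + X i) (sym (ratio-pivot i)) ⟩
        ratio i * M p zero * w₀ + X i
          ≡⟨ cong (_+ X i) (*-assoc (ratio i) _ _) ⟩
        ratio i * (M p zero * w₀) + X i
          ≡⟨ cong (λ a → ratio i * a + X i) pivot-row ⟩
        ratio i * (b p - X p) + X i
          ≡⟨ solve 4 (λ r B x y → r :* (B :- y) :+ x := x :- r :* y :+ r :* B) refl (ratio i) (b p) (X i) (X p) ⟩
        X i - ratio i * X p + ratio i * b p
          ≡⟨ cong (_+ ratio i * b p) (eliminated-row i) ⟩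
        b i - ratio i * b p + ratio i * b p
          ≡⟨ solve 2 (λ x y → x :- y :+ y := x) refl (b i) (ratio i * b p) ⟩
        b i ∎

    lift-obstruction : Obstructed M′ (eliminate b) → Obstructed M b
    lift-obstruction (y′ , y′M′≡0 , y′b′≢0) = y , yM≡0 , y′b′≢0 ∘ trans (sym (adjoint b))
      where
      K = sum (λ i → y′ i * ratio i)
      y : Fin m → ℚ
      y i = y′ i - K * δ p i
      adjoint : ∀ c → sum (λ i → y i * c i) ≡ sum (λ i → y′ i * eliminate c i)
      adjoint c = begin
        sum (λ i → (y′ i - K * δ p i) * c i)
          ≡⟨ sum-cong-≗ (λ i → solve 4 (λ a k d x → (a :- k :* d) :* x := a :* x :- k :* (d :* x))
                                        refl (y′ i) K (δ p i) (c i)) ⟩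
        sum (λ i → y′ i * c i - K * (δ p i * c i))
          ≡⟨ sum-sub-scaled (λ i → y′ i * c i) (λ i → δ p i * c i) K ⟩
        sum (λ i → y′ i * c i) - K * sum (λ i → δ p i * c i)
          ≡⟨ cong (λ s → sum (λ i → y′ i * c i) - s)
                  (trans (cong (K *_) (sum-δ p c)) (*-comm K (c p))) ⟩
        sum (λ i → y′ i * c i) - c p * K
          ≡⟨ sym (sum-sub-scaled (λ i → y′ i * c i) (λ i → y′ i * ratio i) (c p)) ⟩
        sum (λ i → y′ i * c i - c p * (y′ i * ratio i))
          ≡⟨ sum-cong-≗ (λ i → solve 4 (λ a x cp r → a :* x :- cp :* (a :* r) := a :* (x :- r :* cp))
                                        refl (y′ i) (c i) (c p) (ratio i)) ⟩
        sum (λ i → y′ i * eliminate c i) ∎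
      pivot-column-eliminated : ∀ i → eliminate (λ i → M i zero) i ≡ 0ℚ
      pivot-column-eliminated i = trans (cong (λ a → M i zero - a) (ratio-pivot i)) (+-inverseʳ (M i zero))
      yM≡0 : ∀ j → sum (λ i → y i * M i j) ≡ 0ℚ
      yM≡0 zero    = trans (adjoint (λ i → M i zero)) (sum-zero λ i →
                       trans (cong (y′ i *_) (pivot-column-eliminated i)) (*-zeroʳ (y′ i)))
      yM≡0 (suc j) = trans (adjoint (λ i → M i (suc j))) (y′M′≡0 j)

  fredholm : ∀ {m} k (M : Fin m → Fin k → ℚ) b → Solvable M b ⊎ Obstructed M b
  fredholm zero M b with all? (λ i → b i ≟ℚ 0ℚ)
  ... | yes b≡0 = inj₁ ((λ ()) , λ i → sym (b≡0 i))
  ... | no b≢0 with ¬∀⟶∃¬ _ _ (λ i → b i ≟ℚ 0ℚ) b≢0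
  ...   | p , bp≢0 = inj₂ (δ p , (λ ()) , bp≢0 ∘ trans (sym (sum-δ p b)))
  fredholm (suc k) M b with all? (λ i → M i zero ≟ℚ 0ℚ)
  ... | yes M·0≡0 = map lift-solution lift-obstruction (fredholm k M′ b)
    where open ZeroColumn M b M·0≡0
  ... | no M·0≢0 with ¬∀⟶∃¬ _ _ (λ i → M i zero ≟ℚ 0ℚ) M·0≢0
  ...   | p , pivot≢0 = map lift-solution lift-obstruction (fredholm k M′ (eliminate b))
    where open Pivot M b p pivot≢0

open Fredholm using (Solvable; Obstructed; fredholm)

module Rows {n} (G : Graph n) where

  open import Data.Rational.Base using (_*_)
  open import Data.Rational.Properties using (*-identityˡ; *-zeroˡ; *-comm)

  adjacency : Fin n → Fin n → ℚ
  adjacency u v = if adj G u v then 1ℚ else 0ℚ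

  neighbour-term : ∀ (x : Fin n → ℚ) {v u} →
                   adj G v u ≡ true → (if adj G v u then x u else 0ℚ) ≡ x u
  neighbour-term x vu rewrite vu = refl

  nonzero-term⇒adj : ∀ (x : Fin n → ℚ) {v u} →
                     (if adj G v u then x u else 0ℚ) ≢ 0ℚ → adj G v u ≡ true
  nonzero-term⇒adj x {v} {u} term≢0 with adj G v u
  ... | true  = refl
  ... | false = contradiction refl term≢0

  Aℚ-as-sum : ∀ x v → Aℚ G x v ≡ sum (λ u → adjacency v u * x u)
  Aℚ-as-sum x v =
    trans (Σℚ≗sum (λ u → if adj G v u then x u else 0ℚ)) (sum-cong-≗ λ u → sym (scale (adj G v u) (x u)))
    where
    scale : ∀ b x → (if b then 1ℚ else 0ℚ) * x ≡ (if b then x else 0ℚ)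
    scale true  x = *-identityˡ x
    scale false x = *-zeroˡ x

  row-vanishes : ∀ {x v} → (∀ {u} → adj G v u ≡ true → x u ≡ 0ℚ) → Aℚ G x v ≡ 0ℚ
  row-vanishes {x} {v} x≡0 = trans (Σℚ≗sum (λ u → if adj G v u then x u else 0ℚ)) (sum-zero term≡0)
    where
    term≡0 : ∀ u → (if adj G v u then x u else 0ℚ) ≡ 0ℚ
    term≡0 u with adj G v u in vu
    ... | true  = x≡0 vu
    ... | false = refl

  supp-or-solvable : ∀ v → Supp G U v ⊎ ∃ λ w → ∀ u → Aℚ G w u ≡ δ v u
  supp-or-solvable v with fredholm n adjacency (δ v)
  ... | inj₁ (w , Aw≡δ) = inj₂ (w , λ u → trans (Aℚ-as-sum w u) (Aw≡δ u))
  ... | inj₂ (y , yA≡0 , yδ≢0) = inj₁ (y , ((λ _ ¬⊤ → contradiction tt ¬⊤) , λ u _ → Ay≡0 u) , yv≢0)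
    where
    Ay≡0 : ∀ u → Aℚ G y u ≡ 0ℚ
    Ay≡0 u = trans (Aℚ-as-sum y u) (trans (sum-cong-≗ λ w →
      trans (cong (λ b → (if b then 1ℚ else 0ℚ) * y w) (adj-sym G u w)) (*-comm _ (y w))) (yA≡0 u))
    yv≢0 : y v ≢ 0ℚ
    yv≢0 = yδ≢0 ∘ trans (trans (sum-cong-≗ λ u → *-comm (y u) (δ v u)) (sum-δ v y))

module SignWalks where

  open import Data.Fin.Properties using (toℕ-inject₁; toℕ-fromℕ; toℕ-injective; toℕ<n; pigeonhole)
  open import Data.Nat.Base using (_+_; _<_; _≤_; z≤n; s≤s)
  open import Data.Nat.Divisibility using (_∣_; divides)
  open import Data.Nat.Induction using (<-rec)
  open import Data.Nat.Properties
    using (+-suc; +-comm; suc-injective; +-cancelʳ-≡; <⇒≱; ≰⇒>; +-mono-≤; +-monoˡ-≤; <-cmp; n<1+n;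
           ≤-pred; m≤n⇒∃[o]m+o≡n; <-trans)
  open import Data.Nat.Solver using (module +-*-Solver)

  data Halves : ℕ → Set where
    even : ∀ q → Halves (q + q)
    odd  : ∀ q → Halves (suc (q + q))

  halves : ∀ a → Halves a
  halves zero = even 0
  halves (suc a) with halves a
  ... | even q = odd q
  ... | odd q  = subst Halves (cong suc (+-suc q q)) (even (suc q))

  q+q<L+L⇒q<L : ∀ {q L} → q + q < L + L → q < L
  q+q<L+L⇒q<L q+q<L+L = ≰⇒> λ L≤q → <⇒≱ q+q<L+L (+-mono-≤ L≤q L≤q)

  alternating-period-even : (σ : ℕ → Bool) → (∀ k → σ (suc k) ≡ not (σ k)) →
                            ∀ d {i} → σ (d + i) ≡ σ i → ∃ λ h → d ≡ h + h
  alternating-period-even σ alt zero          _ = 0 , refl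
  alternating-period-even σ alt (suc zero)    {i} σ1+i≡σi =
    contradiction (trans (sym (alt i)) σ1+i≡σi) (not-¬ refl ∘ sym)
  alternating-period-even σ alt (suc (suc d)) {i} σ2+d+i≡σi
    with alternating-period-even σ alt d (trans (sym two-steps) σ2+d+i≡σi)
    where
    two-steps : σ (suc (suc d) + i) ≡ σ (d + i)
    two-steps = trans (alt (suc (d + i))) (trans (cong not (alt (d + i))) (not-involutive _))
  ... | h , d≡h+h = suc h , cong suc (trans (cong suc d≡h+h) (sym (+-suc h h)))

  zigzag : ∀ {n} → (Fin n → Fin n) → (ℕ → Fin n) → ℕ → Fin n
  zigzag p s zero          = s 0
  zigzag p s (suc zero)    = p (s 0)
  zigzag p s (suc (suc a)) = zigzag p (s ∘ suc) a

  zigzag-even : ∀ {n} (p : Fin n → Fin n) s q → zigzag p s (q + q) ≡ s q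
  zigzag-even p s zero    = refl
  zigzag-even p s (suc q) = trans (cong (λ a → zigzag p s (suc a)) (+-suc q q)) (zigzag-even p (s ∘ suc) q)

  zigzag-odd : ∀ {n} (p : Fin n → Fin n) s q → zigzag p s (suc (q + q)) ≡ p (s q)
  zigzag-odd p s zero    = refl
  zigzag-odd p s (suc q) = trans (cong (λ a → zigzag p s (suc (suc a))) (+-suc q q)) (zigzag-odd p (s ∘ suc) q)

  zigzag-step : ∀ {n} {R : Fin n → Fin n → Set} p s →
                (∀ k → R (s k) (p (s k))) → (∀ k → R (p (s k)) (s (suc k))) →
                ∀ a → R (zigzag p s a) (zigzag p s (suc a))
  zigzag-step p s out back zero          = out 0
  zigzag-step p s out back (suc zero)    = back 0
  zigzag-step {R = R} p s out back (suc (suc a)) = zigzag-step {R = R} p (s ∘ suc) (out ∘ suc) (back ∘ suc) a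

  module Bipartition {n} (G : Graph n) (bip : Bipartite G) where

    colour : Fin n → Bool
    colour = proj₁ bip

    colour-differs : ∀ {u v} → adj G u v ≡ true → colour u ≢ colour v
    colour-differs = proj₂ bip _ _

    colour-flips : ∀ {u v} → adj G u v ≡ true → colour v ≡ not (colour u)
    colour-flips uv = ¬-not (colour-differs (edge-sym G uv))

    zigzag-cycle : ∀ (p : Fin n → Fin n) (s : ℕ → Fin n) q → 1 ≤ q → Injective _≡_ _≡_ p →
                   (∀ k → adj G (s k) (p (s k)) ≡ true) → (∀ k → adj G (p (s k)) (s (suc k)) ≡ true) →
                   (∀ {a b} → a ≤ q → b ≤ q → s a ≡ s b → a ≡ b) → s (suc q) ≡ s 0 →
                   IsCycle G (suc (q + q)) (zigzag p s ∘ toℕ)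
    zigzag-cycle p s q@(suc _) (s≤s z≤n) p-inj out back s-inj returns =
      s≤s (s≤s (s≤s z≤n)) , toℕ-injective ∘ injective (toℕ<n _) (toℕ<n _) , edge , closing
      where
      base-colour : ∀ k → colour (s k) ≡ colour (s 0)
      base-colour zero    = refl
      base-colour (suc k) = trans (colour-flips (back k))
        (trans (cong not (colour-flips (out k))) (trans (not-involutive _) (base-colour k)))
      base≢out : ∀ a b → s a ≢ p (s b)
      base≢out a b sa≡psb =
        colour-differs (out b) (trans (trans (base-colour b) (sym (base-colour a))) (cong colour sa≡psb))
      even-bound : ∀ {i} → i + i < suc (suc (q + q)) → i ≤ q
      even-bound {i} i+i< = ≤-pred (q+q<L+L⇒q<L (subst (i + i <_) (cong suc (sym (+-suc q q))) i+i<))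
      odd-bound : ∀ {i} → suc (i + i) < suc (suc (q + q)) → i ≤ q
      odd-bound 1+i+i< = even-bound (<-trans (n<1+n _) 1+i+i<)
      injective : ∀ {a b} → a < suc (suc (q + q)) → b < suc (suc (q + q)) →
                  zigzag p s a ≡ zigzag p s b → a ≡ b
      injective {a} {b} a< b< za≡zb with halves a | halves b
      ... | even i | even j = cong (λ k → k + k) (s-inj (even-bound a<) (even-bound b<)
                                (subst₂ _≡_ (zigzag-even p s i) (zigzag-even p s j) za≡zb))
      ... | odd i  | odd j  = cong (λ k → suc (k + k)) (s-inj (odd-bound a<) (odd-bound b<)
                                (p-inj (subst₂ _≡_ (zigzag-odd p s i) (zigzag-odd p s j) za≡zb)))
      ... | even i | odd j  = contradiction (subst₂ _≡_ (zigzag-even p s i) (zigzag-odd p s j) za≡zb)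
                                              (base≢out i j)
      ... | odd i  | even j = contradiction (subst₂ _≡_ (zigzag-even p s j) (zigzag-odd p s i) (sym za≡zb))
                                              (base≢out j i)
      edge : ∀ (i : Fin (suc (q + q))) →
             adj G (zigzag p s (toℕ (inject₁ i))) (zigzag p s (suc (toℕ i))) ≡ true
      edge i = subst (λ a → adj G (zigzag p s a) (zigzag p s (suc (toℕ i))) ≡ true) (sym (toℕ-inject₁ i))
                     (zigzag-step {R = λ u v → adj G u v ≡ true} p s out back (toℕ i))
      closing : adj G (zigzag p s (toℕ (fromℕ (suc (q + q))))) (s 0) ≡ true
      closing = subst₂ (λ u v → adj G u v ≡ true)
                  (sym (trans (cong (zigzag p s) (toℕ-fromℕ (suc (q + q)))) (zigzag-odd p s q))) returns (back q)

  i<j⇒∃[q]1+q+i≡j : ∀ {i j} → i < j → ∃ λ q → suc q + i ≡ j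
  i<j⇒∃[q]1+q+i≡j {i} i<j =
    let o , i+o≡j = m≤n⇒∃[o]m+o≡n i<j in o , trans (cong suc (+-comm o i)) i+o≡j

  1+d≡h+h⇒1≤d : ∀ {d} h → suc d ≡ h + h → 1 ≤ d
  1+d≡h+h⇒1≤d (suc h) d≡h+h = subst (1 ≤_) (sym (trans (suc-injective d≡h+h) (+-suc h h))) (s≤s z≤n)

  d≡h+h⇒4∣d+d : ∀ {d} h → d ≡ h + h → 4 ∣ d + d
  d≡h+h⇒4∣d+d h d≡h+h =
    divides h (trans (cong₂ _+_ d≡h+h d≡h+h) (solve 1 (λ h → (h :+ h) :+ (h :+ h) := h :* con 4) refl h))
    where open +-*-Solver

  module SignWalk {n} (G : Graph n) (bip : Bipartite G) (free : C4kFree G)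
    (T : Fin n → Set) (p : Fin n → Fin n) (x : Fin n → ℚ)
    (p-injective : Injective _≡_ _≡_ p)
    (p-adj : ∀ {t} → T t → adj G t (p t) ≡ true)
    (p-row : ∀ {t} → T t → Aℚ G x (p t) ≡ 0ℚ)
    (closed : ∀ {t u} → T t → adj G (p t) u ≡ true → x u ≢ 0ℚ → T u) where

    open Bipartition G bip
    open Rows G

    Live : Fin n → Set
    Live t = T t × x t ≢ 0ℚ

    opposite-neighbour : ∀ {t} → Live t →
                         ∃ λ u → Live u × adj G (p t) u ≡ true × sign (x u) ≡ not (sign (x t))
    opposite-neighbour {t} (Tt , xt≢0) =
      u , (closed Tt ptu xu≢0 , xu≢0) , ptu ,
      trans (cong sign (sym term-u)) (trans flips (cong (not ∘ sign) term-t))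
      where
      term = λ u → if adj G (p t) u then x u else 0ℚ
      term-t : term t ≡ x t
      term-t = neighbour-term x (edge-sym G (p-adj Tt))
      change = zero-sum⇒sign-change (trans (sym (Σℚ≗sum term)) (p-row Tt)) (xt≢0 ∘ trans (sym term-t))
      u = proj₁ change
      ptu : adj G (p t) u ≡ true
      ptu = nonzero-term⇒adj x (proj₁ (proj₂ change))
      term-u : term u ≡ x u
      term-u = neighbour-term x ptu
      xu≢0 : x u ≢ 0ℚ
      xu≢0 = proj₁ (proj₂ change) ∘ trans term-u
      flips : sign (term u) ≡ not (sign (term t))
      flips = proj₂ (proj₂ change)

    module Walk (start : Σ (Fin n) Live) where

      walk : ℕ → Σ (Fin n) Live
      walk zero    = start
      walk (suc k) = let next = opposite-neighbour (proj₂ (walk k)) in proj₁ next , proj₁ (proj₂ next)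

      vertex : ℕ → Fin n
      vertex k = proj₁ (walk k)

      walk-adj : ∀ k → adj G (p (vertex k)) (vertex (suc k)) ≡ true
      walk-adj k = proj₁ (proj₂ (proj₂ (opposite-neighbour (proj₂ (walk k)))))

      σ : ℕ → Bool
      σ k = sign (x (vertex k))

      σ-alternates : ∀ k → σ (suc k) ≡ not (σ k)
      σ-alternates k = proj₂ (proj₂ (proj₂ (opposite-neighbour (proj₂ (walk k)))))

      Repeat : ℕ → Set
      Repeat j = ∃ λ i → i < j × vertex i ≡ vertex j

      first-repeat-impossible : ∀ {j} → Repeat j → (∀ {j′} → j′ < j → ¬ Repeat j′) → ⊥
      first-repeat-impossible {j} (i , i<j , vi≡vj) earlier =
        free (suc (q + q)) (zigzag p s ∘ toℕ)
          (zigzag-cycle p s q (1+d≡h+h⇒1≤d h period) p-injective out back s-injective returns)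
          (subst (4 ∣_) (cong suc (+-suc q q)) (d≡h+h⇒4∣d+d h period))
        where
        q = proj₁ (i<j⇒∃[q]1+q+i≡j i<j)
        j≡ : suc q + i ≡ j
        j≡ = proj₂ (i<j⇒∃[q]1+q+i≡j i<j)
        s : ℕ → Fin n
        s k = vertex (k + i)
        returns : s (suc q) ≡ s 0
        returns = trans (cong vertex j≡) (sym vi≡vj)
        half-period = alternating-period-even σ σ-alternates (suc q) (cong (sign ∘ x) returns)
        h = proj₁ half-period
        period : suc q ≡ h + h
        period = proj₂ half-period
        out : ∀ k → adj G (s k) (p (s k)) ≡ true
        out k = p-adj (proj₁ (proj₂ (walk (k + i))))
        back : ∀ k → adj G (p (s k)) (s (suc k)) ≡ true
        back k = walk-adj (k + i)
        distinct : ∀ {a b} → a < j → b < j → vertex a ≡ vertex b → a ≡ b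
        distinct {a} {b} a<j b<j va≡vb with <-cmp a b
        ... | tri< a<b _ _ = contradiction (a , a<b , va≡vb) (earlier b<j)
        ... | tri≈ _ a≡b _ = a≡b
        ... | tri> _ _ b<a = contradiction (b , b<a , sym va≡vb) (earlier a<j)
        below-j : ∀ {a} → a ≤ q → a + i < j
        below-j a≤q = subst (_ <_) j≡ (s≤s (+-monoˡ-≤ i a≤q))
        s-injective : ∀ {a b} → a ≤ q → b ≤ q → s a ≡ s b → a ≡ b
        s-injective {a} {b} a≤q b≤q = +-cancelʳ-≡ i a b ∘ distinct (below-j a≤q) (below-j b≤q)

      no-repeat : ∀ j → ¬ Repeat j
      no-repeat = <-rec (λ j → ¬ Repeat j) (λ j earlier repeat → first-repeat-impossible repeat earlier)

      impossible : ⊥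
      impossible with pigeonhole (n<1+n n) (vertex ∘ toℕ)
      ... | i , j , i<j , vi≡vj = no-repeat (toℕ j) (toℕ i , i<j , vi≡vj)

    vanishes : ∀ {t} → T t → x t ≡ 0ℚ
    vanishes {t} Tt = decidable-stable (x t ≟ℚ 0ℚ) (λ xt≢0 → Walk.impossible (t , Tt , xt≢0))

open SignWalks using (module Bipartition; module SignWalk)

module MovedPoints where

  open import Data.Fin.Permutation using (Permutation; _⟨$⟩ʳ_; _⟨$⟩ˡ_; inverseˡ; inverseʳ)
  open import Data.Fin.Permutation.Components using (transpose)
  open import Data.Nat.Base using (_≤_; _<_; z≤n)
  open import Data.Nat.Properties using (+-mono-≤; +-mono-<-≤; ≤-refl)
    renaming (+-0-commutativeMonoid to ℕ-+-0)
  import Algebra.Properties.CommutativeMonoid.Sum ℕ-+-0 as ℕΣ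

  transpose-left : ∀ {n} (i j : Fin n) → transpose i j i ≡ j
  transpose-left i j rewrite dec-true (i ≟ᶠ i) refl = refl

  transpose-right : ∀ {n} (i j : Fin n) → transpose i j j ≡ i
  transpose-right i j with j ≟ᶠ i
  ... | yes refl = refl
  ... | no _ rewrite dec-true (j ≟ᶠ j) refl = refl

  transpose-other : ∀ {n} {i j k : Fin n} → k ≢ i → k ≢ j → transpose i j k ≡ k
  transpose-other {i = i} {j} {k} k≢i k≢j
    rewrite dec-false (k ≟ᶠ i) k≢i | dec-false (k ≟ᶠ j) k≢j = refl

  moved : ∀ {n} → (Fin n → Fin n) → Fin n → ℕ
  moved μ v = if does (μ v ≟ᶠ v) then 0 else 1

  movedCount : ∀ {n} → (Fin n → Fin n) → ℕ
  movedCount μ = ℕΣ.sum (moved μ)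

  moved-≤1 : ∀ {n} (μ : Fin n → Fin n) v → moved μ v ≤ 1
  moved-≤1 μ v with does (μ v ≟ᶠ v)
  ... | true  = z≤n
  ... | false = ≤-refl

  moved-mono : ∀ {n} {μ μ′ : Fin n → Fin n} {v} → (μ v ≢ v → μ′ v ≢ v) → moved μ v ≤ moved μ′ v
  moved-mono {μ = μ} {μ′} {v} preserved with μ v ≟ᶠ v | μ′ v ≟ᶠ v
  ... | yes _    | _        = z≤n
  ... | no μv≢v  | yes μ′v≡v = contradiction μ′v≡v (preserved μv≢v)
  ... | no _     | no _      = ≤-refl

  moved-fixed : ∀ {n} {μ : Fin n → Fin n} {v} → μ v ≡ v → moved μ v ≡ 0
  moved-fixed {μ = μ} {v} μv≡v rewrite dec-true (μ v ≟ᶠ v) μv≡v = refl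

  moved-unfixed : ∀ {n} {μ : Fin n → Fin n} {v} → μ v ≢ v → moved μ v ≡ 1
  moved-unfixed {μ = μ} {v} μv≢v rewrite dec-false (μ v ≟ᶠ v) μv≢v = refl

  sum-≤-length : ∀ {n} {f : Fin n → ℕ} → (∀ i → f i ≤ 1) → ℕΣ.sum f ≤ n
  sum-≤-length {zero}  f≤1 = z≤n
  sum-≤-length {suc n} f≤1 = +-mono-≤ (f≤1 zero) (sum-≤-length (f≤1 ∘ suc))

  sum-mono-≤ : ∀ {n} {f g : Fin n → ℕ} → (∀ i → f i ≤ g i) → ℕΣ.sum f ≤ ℕΣ.sum g
  sum-mono-≤ {zero}  f≤g = z≤n
  sum-mono-≤ {suc n} f≤g = +-mono-≤ (f≤g zero) (sum-mono-≤ (f≤g ∘ suc))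

  sum-mono-< : ∀ {n} {f g : Fin n → ℕ} {a} → (∀ i → f i ≤ g i) → f a < g a → ℕΣ.sum f < ℕΣ.sum g
  sum-mono-< {suc n} {f} {g} {a} f≤g fa<ga =
    subst₂ _<_ (sym (ℕΣ.sum-remove {i = a} f)) (sym (ℕΣ.sum-remove {i = a} g))
           (+-mono-<-≤ fa<ga (sum-mono-≤ (f≤g ∘ punchIn a)))

  conjugate : ∀ {n} → Permutation n n → (Fin n → Fin n) → Fin n → Fin n
  conjugate π μ v = π ⟨$⟩ˡ μ (π ⟨$⟩ʳ v)

  conjugate-involutive : ∀ {n} (π : Permutation n n) (μ : Fin n → Fin n) →
                         (∀ v → μ (μ v) ≡ v) → ∀ v → conjugate π μ (conjugate π μ v) ≡ v
  conjugate-involutive π μ μ-inv v = begin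
    π ⟨$⟩ˡ μ (π ⟨$⟩ʳ (π ⟨$⟩ˡ μ (π ⟨$⟩ʳ v))) ≡⟨ cong (λ w → π ⟨$⟩ˡ μ w) (inverseʳ π) ⟩
    π ⟨$⟩ˡ μ (μ (π ⟨$⟩ʳ v))                 ≡⟨ cong (π ⟨$⟩ˡ_) (μ-inv _) ⟩
    π ⟨$⟩ˡ (π ⟨$⟩ʳ v)                       ≡⟨ inverseˡ π ⟩
    v                                       ∎
    where open ≡-Reasoning

  movedCount-conjugate : ∀ {n} (π : Permutation n n) μ → movedCount (conjugate π μ) ≡ movedCount μ
  movedCount-conjugate π μ = trans (ℕΣ.sum-cong-≗ moved-conjugate) (sym (ℕΣ.∑-permute (moved μ) π))
    where
    conjugate-fixed : ∀ v → conjugate π μ v ≡ v → μ (π ⟨$⟩ʳ v) ≡ π ⟨$⟩ʳ v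
    conjugate-fixed v e = trans (sym (inverseʳ π)) (cong (π ⟨$⟩ʳ_) e)
    moved-conjugate : ∀ v → moved (conjugate π μ) v ≡ moved μ (π ⟨$⟩ʳ v)
    moved-conjugate v with μ (π ⟨$⟩ʳ v) ≟ᶠ π ⟨$⟩ʳ v
    ... | yes e = moved-fixed {μ = conjugate π μ} (trans (cong (π ⟨$⟩ˡ_) e) (inverseˡ π))
    ... | no ne = moved-unfixed {μ = conjugate π μ} (ne ∘ conjugate-fixed v)

open MovedPoints

module Matchings {n} (G : Graph n) (bip : Bipartite G) where

  open import Data.Fin.Permutation using (Permutation)
  import Data.Fin.Permutation as Perm
  open import Data.Fin.Permutation.Components using (transpose)
  open import Data.Nat.Base using (_+_; _≤_; _<_; s≤s)
  open import Data.Nat.Induction using (<-rec)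
  open import Data.Nat.Properties
    using (≤-refl; ≤-trans; <⇒≱; ≮⇒≥; m≤n+m; n<1+n; m<n⇒m<1+n; +-identityʳ; +-suc; +-monoˡ-≤)
  open import Data.Product using (∃₂)

  open Bipartition G bip

  -- A matching is stored as the involution sending each vertex to its partner and fixing unmatched ones.
  record Matching : Set where
    field
      mate            : Fin n → Fin n
      mate-involutive : ∀ v → mate (mate v) ≡ v
      mate-adj        : ∀ {v} → mate v ≢ v → adj G v (mate v) ≡ true
  open Matching public

  Unmatched Matched : Matching → Fin n → Set
  Unmatched m v = mate m v ≡ v
  Matched   m v = mate m v ≢ v

  size : Matching → ℕ
  size m = movedCount (mate m)

  Maximum : Matching → Set
  Maximum m = ∀ m′ → size m′ ≤ size m

  adj⇒≢ : ∀ {u v} → adj G u v ≡ true → u ≢ v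
  adj⇒≢ {u} uv refl = contradiction (trans (sym uv) (irrefl G u)) λ ()

  module _ (m : Matching) where

    mate-injective : ∀ {v w} → mate m v ≡ mate m w → v ≡ w
    mate-injective {v} {w} e = trans (sym (mate-involutive m v)) (trans (cong (mate m) e) (mate-involutive m w))

    mate≡unmatched : ∀ {v z} → Unmatched m z → mate m v ≡ z → v ≡ z
    mate≡unmatched z-free e = mate-injective (trans e (sym z-free))

    mate-matched : ∀ {v} → Matched m v → Matched m (mate m v)
    mate-matched {v} v-matched e = v-matched (sym (trans (sym (mate-involutive m v)) e))

    mate-neighbour-colour : ∀ {t u} → Matched m t → adj G (mate m t) u ≡ true → colour u ≡ colour t
    mate-neighbour-colour t-matched mt∼u =
      trans (colour-flips mt∼u) (trans (cong not (colour-flips (mate-adj m t-matched))) (not-involutive _))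

    alternating-colour : ∀ {a r} → adj G a r ≡ true → Matched m r → colour (mate m r) ≡ colour a
    alternating-colour ar r-matched =
      trans (colour-flips (mate-adj m r-matched)) (trans (cong not (colour-flips ar)) (not-involutive _))

  size≤n : ∀ m → size m ≤ n
  size≤n m = sum-≤-length (moved-≤1 (mate m))

  empty : Matching
  empty = record
    { mate = λ v → v ; mate-involutive = λ _ → refl ; mate-adj = λ v≢v → contradiction refl v≢v }

  module Augment (m : Matching) {a r} (a-free : Unmatched m a) (r-free : Unmatched m r)
                 (ar : adj G a r ≡ true) where

    mate′ : Fin n → Fin n
    mate′ v = transpose a r (mate m v)

    mate′-a : mate′ a ≡ r
    mate′-a = trans (cong (transpose a r) a-free) (transpose-left a r)

    mate′-r : mate′ r ≡ a
    mate′-r = trans (cong (transpose a r) r-free) (transpose-right a r)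

    avoids : ∀ {v} → v ≢ a → v ≢ r → mate m v ≢ a × mate m v ≢ r
    avoids v≢a v≢r = v≢a ∘ mate≡unmatched m a-free , v≢r ∘ mate≡unmatched m r-free

    mate′-other : ∀ {v} → v ≢ a → v ≢ r → mate′ v ≡ mate m v
    mate′-other v≢a v≢r = transpose-other (proj₁ (avoids v≢a v≢r)) (proj₂ (avoids v≢a v≢r))

    involutive : ∀ v → mate′ (mate′ v) ≡ v
    involutive v with v ≟ᶠ a | v ≟ᶠ r
    ... | yes refl | _        = trans (cong mate′ mate′-a) mate′-r
    ... | no _     | yes refl = trans (cong mate′ mate′-r) mate′-a
    ... | no v≢a   | no v≢r   = trans (cong mate′ (mate′-other v≢a v≢r))
      (trans (mate′-other (proj₁ (avoids v≢a v≢r)) (proj₂ (avoids v≢a v≢r))) (mate-involutive m v))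

    adjacent : ∀ {v} → mate′ v ≢ v → adj G v (mate′ v) ≡ true
    adjacent {v} v-moved with v ≟ᶠ a | v ≟ᶠ r
    ... | yes refl | _        = subst (λ w → adj G a w ≡ true) (sym mate′-a) ar
    ... | no _     | yes refl = subst (λ w → adj G r w ≡ true) (sym mate′-r) (edge-sym G ar)
    ... | no v≢a   | no v≢r   = subst (λ w → adj G v w ≡ true) (sym (mate′-other v≢a v≢r))
                                      (mate-adj m (v-moved ∘ trans (mate′-other v≢a v≢r)))

    augmented : Matching
    augmented = record { mate = mate′ ; mate-involutive = involutive ; mate-adj = adjacent }

    grows : size m < size augmented
    grows = sum-mono-< {f = moved (mate m)} {g = moved mate′} {a = a}
      (λ v → moved-mono {μ = mate m} {μ′ = mate′} (stays-matched v))
      (subst₂ _<_ (sym (moved-fixed {μ = mate m} a-free)) (sym (moved-unfixed {μ = mate′} a-moved)) ≤-refl)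
      where
      a-moved : mate′ a ≢ a
      a-moved e = adj⇒≢ ar (trans (sym e) mate′-a)
      stays-matched : ∀ v → mate m v ≢ v → mate′ v ≢ v
      stays-matched v v-matched = v-matched ∘ trans (sym (mate′-other v≢a v≢r))
        where
        v≢a : v ≢ a
        v≢a refl = v-matched a-free
        v≢r : v ≢ r
        v≢r refl = v-matched r-free

  data Reach (m : Matching) : ℕ → Fin n → Fin n → Set where
    here : ∀ {a} → Reach m 0 a a
    step : ∀ {k a r v} → adj G a r ≡ true → Matched m r → Reach m k (mate m r) v → Reach m (suc k) a v

  Reachable : Matching → Fin n → Set
  Reachable m v = ∃₂ λ k a → Unmatched m a × Reach m k a v

  Reach-colour : ∀ {m k a v} → Reach m k a v → colour v ≡ colour a
  Reach-colour         here                   = refl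
  Reach-colour {m} (step ar r-matched rest) = trans (Reach-colour rest) (alternating-colour m ar r-matched)

  Reach-snoc : ∀ {m k a v r} → Reach m k a v → adj G v r ≡ true → Matched m r →
               Reach m (suc k) a (mate m r)
  Reach-snoc here                     vr r-matched = step vr r-matched here
  Reach-snoc (step ar r′-matched rest) vr r-matched = step ar r′-matched (Reach-snoc rest vr r-matched)

  reachable-step : ∀ {m v r} → Reachable m v → adj G v r ≡ true → Matched m r → Reachable m (mate m r)
  reachable-step (k , a , a-free , path) vr r-matched = suc k , a , a-free , Reach-snoc path vr r-matched

  record Unmatching (m : Matching) (v : Fin n) : Set where
    field
      matching   : Matching
      same-size  : size matching ≡ size m
      frees      : Unmatched matching v
      keeps-free : ∀ {z} → colour z ≢ colour v → Unmatched m z → Unmatched matching z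

  -- For an alternating path a, r, a₁ = mate r, … starting at the unmatched vertex a, conjugating mate
  -- by the transposition (a a₁) matches a with r, frees a₁ and leaves all other pairs alone.
  module Swap (m : Matching) {a r} (a-free : Unmatched m a) (ar : adj G a r ≡ true)
              (r-matched : Matched m r) where

    a₁ : Fin n
    a₁ = mate m r

    π : Permutation n n
    π = Perm.transpose a₁ a

    mate₁ : Fin n → Fin n
    mate₁ = conjugate π (mate m)

    a≢r : a ≢ r
    a≢r = adj⇒≢ ar

    r≢a₁ : r ≢ a₁
    r≢a₁ = r-matched ∘ sym

    mate₁-a : mate₁ a ≡ r
    mate₁-a = begin
      transpose a a₁ (mate m (transpose a₁ a a)) ≡⟨ cong (transpose a a₁ ∘ mate m) (transpose-right a₁ a) ⟩
      transpose a a₁ (mate m a₁)                 ≡⟨ cong (transpose a a₁) (mate-involutive m r) ⟩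
      transpose a a₁ r                           ≡⟨ transpose-other (a≢r ∘ sym) r≢a₁ ⟩
      r                                          ∎
      where open ≡-Reasoning

    mate₁-r : mate₁ r ≡ a
    mate₁-r = trans (cong (transpose a a₁ ∘ mate m) (transpose-other r≢a₁ (a≢r ∘ sym))) (transpose-right a a₁)

    mate₁-a₁ : mate₁ a₁ ≡ a₁
    mate₁-a₁ = trans (cong (transpose a a₁ ∘ mate m) (transpose-left a₁ a))
                     (trans (cong (transpose a a₁) a-free) (transpose-left a a₁))

    mate₁-other : ∀ {v} → v ≢ a → v ≢ a₁ → v ≢ r → mate₁ v ≡ mate m v
    mate₁-other v≢a v≢a₁ v≢r =
      trans (cong (transpose a a₁ ∘ mate m) (transpose-other v≢a₁ v≢a))
            (transpose-other (v≢a ∘ mate≡unmatched m a-free) (v≢r ∘ mate-injective m))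

    adjacent : ∀ {v} → mate₁ v ≢ v → adj G v (mate₁ v) ≡ true
    adjacent {v} v-moved = by-cases (v ≟ᶠ a) (v ≟ᶠ r) (v ≟ᶠ a₁)
      where
      by-cases : Dec (v ≡ a) → Dec (v ≡ r) → Dec (v ≡ a₁) → adj G v (mate₁ v) ≡ true
      by-cases (yes refl) _          _           = subst (λ w → adj G a w ≡ true) (sym mate₁-a) ar
      by-cases (no _)     (yes refl) _           = subst (λ w → adj G r w ≡ true) (sym mate₁-r) (edge-sym G ar)
      by-cases (no _)     (no _)     (yes refl)  = contradiction mate₁-a₁ v-moved
      by-cases (no v≢a)   (no v≢r)   (no v≢a₁)   =
        subst (λ w → adj G v w ≡ true) (sym (mate₁-other v≢a v≢a₁ v≢r))
              (mate-adj m (v-moved ∘ trans (mate₁-other v≢a v≢a₁ v≢r)))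

    swapped : Matching
    swapped = record
      { mate            = mate₁
      ; mate-involutive = conjugate-involutive π (mate m) (mate-involutive m)
      ; mate-adj        = adjacent
      }

    swapped-size : size swapped ≡ size m
    swapped-size = movedCount-conjugate π (mate m)

    a₁-colour : colour a₁ ≡ colour a
    a₁-colour = alternating-colour m ar r-matched

    swapped-keeps-free : ∀ {z} → colour z ≢ colour a → Unmatched m z → Unmatched swapped z
    swapped-keeps-free {z} z≁a z-free =
      trans (mate₁-other (z≁a ∘ cong colour) (z≁a ∘ flip trans a₁-colour ∘ cong colour) z≢r) z-free
      where
      z≢r : z ≢ r
      z≢r refl = r-matched z-free

    -- A path survives the swap unless it passes through r; the part after r is then a shorter path from a₁.
    lift-or-shortcut : ∀ {k a′ v} → colour a′ ≡ colour a → Reach m k a′ v →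
                       Reach swapped k a′ v ⊎ ∃ λ k′ → k′ < k × Reach m k′ a₁ v
    lift-or-shortcut _ here = inj₁ here
    lift-or-shortcut a′∼a (step {r = r′} a′r′ r′-matched rest) with r′ ≟ᶠ r
    ... | yes refl = inj₂ (_ , n<1+n _ , rest)
    ... | no r′≢r with lift-or-shortcut (trans (alternating-colour m a′r′ r′-matched) a′∼a) rest
    ...   | inj₂ (k′ , k′<k , shortcut) = inj₂ (k′ , m<n⇒m<1+n k′<k , shortcut)
    ...   | inj₁ lifted =
      inj₁ (step a′r′ (r′-matched ∘ trans (sym agrees)) (subst (λ w → Reach swapped _ w _) (sym agrees) lifted))
      where
      r′≁a : colour r′ ≢ colour a
      r′≁a r′∼a = colour-differs a′r′ (trans a′∼a (sym r′∼a))
      agrees : mate₁ r′ ≡ mate m r′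
      agrees = mate₁-other (r′≁a ∘ cong colour) (r′≁a ∘ flip trans a₁-colour ∘ cong colour) r′≢r

    transfer : ∀ {v} → colour v ≡ colour a → Unmatching swapped v → Unmatching m v
    transfer v∼a U = record
      { matching   = matching
      ; same-size  = trans same-size swapped-size
      ; frees      = frees
      ; keeps-free = λ z≁v → keeps-free z≁v ∘ swapped-keeps-free (λ z∼a → z≁v (trans z∼a (sym v∼a)))
      }
      where open Unmatching U

  unmatch : ∀ k {m a v} → Unmatched m a → Reach m k a v → Unmatching m v
  unmatch = <-rec (λ k → ∀ {m a v} → Unmatched m a → Reach m k a v → Unmatching m v) go
    where
    go : ∀ k → (∀ {k′} → k′ < k → ∀ {m a v} → Unmatched m a → Reach m k′ a v → Unmatching m v) →
         ∀ {m a v} → Unmatched m a → Reach m k a v → Unmatching m v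
    go zero    _  {m} a-free here =
      record { matching = m ; same-size = refl ; frees = a-free ; keeps-free = λ _ z-free → z-free }
    go (suc k) ih {m} a-free (step ar r-matched rest) =
      [ transfer (trans (Reach-colour rest) a₁-colour) ∘ ih (n<1+n k) mate₁-a₁
      , (λ (k′ , k′<k , shortcut) → ih (s≤s k′<k) a-free (step ar r-matched shortcut))
      ]′ (lift-or-shortcut a₁-colour rest)
      where open Swap m a-free ar r-matched

  reachable-neighbour-matched : ∀ m {d t} → Maximum m → Reachable m d → adj G d t ≡ true → Matched m t
  reachable-neighbour-matched m maximum (k , a , a-free , path) dt t-free =
    <⇒≱ (subst (_< size augmented) same-size grows) (maximum augmented)
    where
    open Unmatching (unmatch k a-free path)
    open Augment matching frees (keeps-free (colour-differs dt ∘ sym) t-free) dt using (augmented; grows)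

  -- Only up to double negation; this suffices as it is used to prove decidable equations in ℚ.
  maximum-exists : ¬ ¬ Σ Matching Maximum
  maximum-exists no-maximum = climb n empty (m≤n+m n (size empty))
    where
    climb : ∀ k m → n ≤ size m + k → ⊥
    climb zero    m bound = no-maximum (m , λ m′ → ≮⇒≥ λ m<m′ →
      <⇒≱ m<m′ (≤-trans (size≤n m′) (subst (n ≤_) (+-identityʳ (size m)) bound)))
    climb (suc k) m bound = no-maximum (m , λ m′ → ≮⇒≥ λ m<m′ →
      climb k m′ (≤-trans bound (subst (_≤ size m′ + k) (sym (+-suc (size m) k)) (+-monoˡ-≤ k m<m′))))

module NullSpace {n} (G : Graph n) (bip : Bipartite G) (free : C4kFree G) where

  open import Data.Nat.Base using (_≤_)
  open import Data.Rational.Properties using (1≢0)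
  open Rows G
  open Bipartition G bip
  open Matchings G bip

  vanishes-on-matched-closed : ∀ (m : Matching) (T : Fin n → Set) (x : Fin n → ℚ) →
    (∀ {t} → T t → Matched m t) → (∀ {t} → T t → Aℚ G x (mate m t) ≡ 0ℚ) →
    (∀ {t u} → T t → adj G (mate m t) u ≡ true → x u ≢ 0ℚ → T u) →
    ∀ {t} → T t → x t ≡ 0ℚ
  vanishes-on-matched-closed m T x matched rows closed =
    SignWalk.vanishes G bip free T (mate m) x (mate-injective m) (mate-adj m ∘ matched) rows closed

  unmatched-reachable : ∀ {m v} → Unmatched m v → Reachable m v
  unmatched-reachable v-free = 0 , _ , v-free , here

  null-vanishes-off-reachable : ∀ {x} m → IsNull G U x → ∀ {v} → ¬ Reachable m v → x v ≡ 0ℚ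
  null-vanishes-off-reachable {x} m (_ , rows) =
    vanishes-on-matched-closed m (λ t → ¬ Reachable m t) x
      (λ t-unreachable → t-unreachable ∘ unmatched-reachable)
      (λ _ → rows _ tt)
      (λ {t} t-unreachable mt∼u _ u-reachable → t-unreachable (subst (Reachable m) (mate-involutive m t)
         (reachable-step u-reachable (edge-sym G mt∼u) (mate-matched m (t-unreachable ∘ unmatched-reachable)))))

  supp⇒reachable : ∀ m {v} → Supp G U v → ¬ ¬ Reachable m v
  supp⇒reachable m (x , null , xv≢0) v-unreachable = xv≢0 (null-vanishes-off-reachable m null v-unreachable)

  -- Otherwise A w = e_v for some w; the sign walk makes w vanish on the neighbours of v, but (A w)_v = 1.
  unmatched⇒supp : ∀ m {v} → Maximum m → Unmatched m v → Supp G U v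
  unmatched⇒supp m {v} maximum v-free with supp-or-solvable v
  ... | inj₁ v-supp = v-supp
  ... | inj₂ (w , Aw≡δ) =
    contradiction (trans (sym (Aw≡δ v)) (row-vanishes λ vu → w-vanishes (v-side vu)))
                  (1≢0 ∘ trans (sym (δ-diag v)))
    where
    T : Fin n → Set
    T t = colour t ≢ colour v × ∃ λ d → Reachable m d × adj G d t ≡ true
    v-side : ∀ {u} → adj G v u ≡ true → T u
    v-side vu = colour-differs vu ∘ sym , v , unmatched-reachable v-free , vu
    w-vanishes : ∀ {t} → T t → w t ≡ 0ℚ
    w-vanishes = vanishes-on-matched-closed m T w
      t-matched
      (λ Tt → trans (Aw≡δ _) (δ-off λ v≡mt →
         mate-matched m (t-matched Tt) (subst (Unmatched m) v≡mt v-free)))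
      (λ {t} Tt@(t≁v , d , d-reachable , dt) mt∼u _ →
         t≁v ∘ trans (sym (mate-neighbour-colour m (t-matched Tt) mt∼u)) ,
         mate m t , reachable-step d-reachable dt (t-matched Tt) , mt∼u)
      where
      t-matched : ∀ {t} → T t → Matched m t
      t-matched (_ , d , d-reachable , dt) = reachable-neighbour-matched m maximum d-reachable dt

  reachable⇒supp : ∀ m {v} → Maximum m → Reachable m v → Supp G U v
  reachable⇒supp m maximum (k , a , a-free , path) =
    unmatched⇒supp matching (λ m′ → subst (size m′ ≤_) (sym same-size) (maximum m′)) frees
    where open Unmatching (unmatch k a-free path)

  null-CS-vanishes-on-core : ∀ {x v} → IsNull G (CS G) x → Core G U v → x v ≡ 0ℚ
  null-CS-vanishes-on-core {x} {v} (_ , rows) (_ , s , s-supp , vs) =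
    decidable-stable (x v ≟ℚ 0ℚ) λ xv≢0 → maximum-exists λ (m , maximum) →
      supp⇒reachable m s-supp λ s-reachable → xv≢0 (vanishes m maximum (s , s-reachable , vs))
    where
    T : Matching → Fin n → Set
    T m t = ∃ λ d → Reachable m d × adj G t d ≡ true
    vanishes : ∀ m → Maximum m → ∀ {t} → T m t → x t ≡ 0ℚ
    vanishes m maximum = vanishes-on-matched-closed m (T m) x t-matched
      (λ Tt → rows _ (inj₁ (reachable⇒supp m maximum (mate-reachable Tt))))
      (λ {t} Tt mt∼u _ → mate m t , mate-reachable Tt , edge-sym G mt∼u)
      where
      t-matched : ∀ {t} → T m t → Matched m t
      t-matched (d , d-reachable , td) = reachable-neighbour-matched m maximum d-reachable (edge-sym G td)
      mate-reachable : ∀ {t} → T m t → Reachable m (mate m t)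
      mate-reachable Tt@(d , d-reachable , td) = reachable-step d-reachable (edge-sym G td) (t-matched Tt)

  npart-matched : ∀ m {t} → Maximum m → Npart G U t → Matched m t
  npart-matched m maximum (_ , t-unsupp , _) t-free = t-unsupp (unmatched⇒supp m maximum t-free)

  npart-mate : ∀ m {t} → Maximum m → Npart G U t → Npart G U (mate m t)
  npart-mate m {t} maximum Nt@(_ , t-unsupp , t-uncore) = tt , mt-unsupp , mt-uncore
    where
    t-matched : Matched m t
    t-matched = npart-matched m maximum Nt
    mt-unsupp : ¬ Supp G U (mate m t)
    mt-unsupp mt-supp = t-uncore (tt , mate m t , mt-supp , mate-adj m t-matched)
    mt-uncore : ¬ Core G U (mate m t)
    mt-uncore (_ , s , s-supp , mt∼s) = supp⇒reachable m s-supp λ s-reachable →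
      t-unsupp (reachable⇒supp m maximum (subst (Reachable m) (mate-involutive m t)
        (reachable-step s-reachable (edge-sym G mt∼s) (mate-matched m t-matched))))

  null-CN-trivial : ∀ {y} → IsNull G (CN G) y → ∀ v → y v ≡ 0ℚ
  null-CN-trivial {y} (off , rows) v =
    decidable-stable (y v ≟ℚ 0ℚ) λ yv≢0 →
      maximum-exists λ (m , maximum) → yv≢0 (vanishes m maximum yv≢0)
    where
    vanishes : ∀ m → Maximum m → ∀ {t} → y t ≢ 0ℚ → y t ≡ 0ℚ
    vanishes m maximum = vanishes-on-matched-closed m (λ t → y t ≢ 0ℚ) y
      (λ {t} yt≢0 t-free → yt≢0 (off t λ Nt → npart-matched m maximum Nt t-free))
      (λ {t} yt≢0 → decidable-stable (_ ≟ℚ 0ℚ) λ row≢0 →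
         yt≢0 (off t λ Nt → row≢0 (rows _ (npart-mate m maximum Nt))))
      (λ _ _ yu≢0 → yu≢0)

  null⇒null-CS : ∀ {x} → IsNull G U x → IsNull G (CS G) x
  null⇒null-CS {x} null@(_ , rows) =
    (λ u u∉CS → decidable-stable (x u ≟ℚ 0ℚ) λ xu≢0 → u∉CS (inj₁ (x , null , xu≢0))) ,
    λ u _ → rows u tt

  null-CS⇒null : ∀ {x} → IsNull G (CS G) x → IsNull G U x
  null-CS⇒null {x} null@(off , rows) = (λ _ ¬⊤ → contradiction tt ¬⊤) , λ u _ → row u
    where
    outside-neighbour : ∀ {u w} → ¬ CS G u → adj G u w ≡ true → x w ≡ 0ℚ
    outside-neighbour {u} {w} u∉CS uw = decidable-stable (x w ≟ℚ 0ℚ) λ xw≢0 → xw≢0 (off w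
      [ (λ w-supp → u∉CS (inj₂ (tt , w , w-supp , uw)))
      , (λ w-core → xw≢0 (null-CS-vanishes-on-core null w-core))
      ]′)
    row : ∀ u → Aℚ G x u ≡ 0ℚ
    row u = decidable-stable (Aℚ G x u ≟ℚ 0ℚ) λ row≢0 → ¬¬-excluded-middle λ where
      (yes u∈CS) → row≢0 (rows u u∈CS)
      (no u∉CS)  → row≢0 (row-vanishes (outside-neighbour u∉CS))

  supp-CS : Supp G (CS G) ≐ Supp G U
  supp-CS = (λ (x , null , xv≢0) → x , null-CS⇒null null , xv≢0)
          , (λ (x , null , xv≢0) → x , null⇒null-CS null , xv≢0)

  core-CS : Core G (CS G) ≐ Core G U
  core-CS = (λ (_ , u , u-supp , vu) → tt , u , proj₁ supp-CS u-supp , vu)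
          , (λ Cv@(_ , u , u-supp , vu) → inj₂ Cv , u , proj₂ supp-CS u-supp , vu)

  npart-CS-empty : Empty (Npart G (CS G))
  npart-CS-empty _ (v∈CS , v-unsupp , v-uncore) =
    [ v-unsupp ∘ proj₂ supp-CS , v-uncore ∘ proj₂ core-CS ]′ v∈CS

  supp-CN-empty : Empty (Supp G (CN G))
  supp-CN-empty v (y , null , yv≢0) = yv≢0 (null-CN-trivial null v)

  core-CN-empty : Empty (Core G (CN G))
  core-CN-empty _ (_ , u , u-supp , _) = supp-CN-empty u u-supp

  npart-CN : Npart G (CN G) ≐ Npart G U
  npart-CN = proj₁ , λ {v} Nv → Nv , supp-CN-empty v , core-CN-empty v

theorem3p4 : ∀ {n} (G : Graph n) → Bipartite G → C4kFree G →
    (Supp G (CS G) ≐ Supp G U) × (Core G (CS G) ≐ Core G U)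
    × (Npart G (CN G) ≐ Npart G U)
    × Empty (Npart G (CS G)) × Empty (Supp G (CN G)) × Empty (Core G (CN G))
theorem3p4 G bip free = supp-CS , core-CS , npart-CN , npart-CS-empty , supp-CN-empty , core-CN-empty
  where open NullSpace G bip free
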